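{- Let $n\in\mathbb{N}$ and let $a,b$ be distinct divisors of $n$. Let $d=\gcd(a,b)$ and $l=\operatorname{lcm}(a,b)$. Then: (i) The multiset $\Delta(a\mathbb{Z}_n,b\mathbb{Z}_n)$ consists of exactly $\frac{n}{l}$ copies of $d\mathbb{Z}_n$. (ii) If $d>1$, then $$\Delta\Big(\bigcup_{r=0}^{d-1}(r+a\mathbb{Z}_n),\,b\mathbb{Z}_n\Big)=\Delta\Big(a\mathbb{Z}_n,\,\bigcup_{r=0}^{d-1}(r+b\mathbb{Z}_n)\Big)$$ and both equal the multiset consisting of $\frac{n}{l}$ copies of $\mathbb{Z}_n$; i.e. $\{\bigcup_{r=0}^{d-1}(r+a\mathbb{Z}_n),\,b\mathbb{Z}_n\}$ and $\{a\mathbb{Z}_n,\,\bigcup_{r=0}^{d-1}(r+b\mathbb{Z}_n)\}$ are both 2-set non-disjoint GPSEDFs in $\mathbb{Z}_n$ with $\lambda=\frac{n}{l}$.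
   Context: For a divisor $a$ of $n$, $a\mathbb{Z}_n=\{0,a,2a,\dots,n-a\}$ denotes the additive subgroup of $\mathbb{Z}_n$ generated by $a$, and $r+S=\{r+s:s\in S\}$. For subsets $A,B$ of $\mathbb{Z}_n$, $\Delta(A,B)$ denotes the multiset $\{x-y:x\in A,y\in B\}$ (one entry per pair). A family of sets $\{A_1,A_2\}$ in $\mathbb{Z}_n$ with $|A_i|=k_i$ is a non-disjoint $(n,2,k_1,k_2)$-GPSEDF if $\Delta(A_1,A_2)$ and $\Delta(A_2,A_1)$ each contain every element of $\mathbb{Z}_n$ exactly $\lambda=k_1k_2/n$ times. -}

module Defs where

open import Data.Nat using (ℕ; _+_; _*_; _∸_; _%_; NonZero)
open import Data.Nat.Properties using (_≟_)
open import Data.List using (List; map; filter; upTo; concat; replicate; length; cartesianProductWith)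
open import Data.List.Relation.Unary.Any using (any?)
open import Data.List.Membership.DecPropositional _≟_ using (_∈?_)
open import Data.List.Relation.Binary.Permutation.Propositional using (_↭_)
open import Data.Product using (_×_)
open import Relation.Binary.PropositionalEquality using (_≡_)

-- Elements of ℤ_n are the naturals 0,…,n-1; a subset of ℤ_n is a
-- duplicate-free list of such naturals; a multiset is a list up to
-- permutation (_↭_).

Zn : ℕ → List ℕ
Zn n = upTo n

subgroup : (n : ℕ) .{{_ : NonZero n}} → ℕ → List ℕ
subgroup n a = filter (λ x → any? (λ k → (k * a) % n ≟ x) (upTo n)) (upTo n)

shift : (n : ℕ) .{{_ : NonZero n}} → ℕ → List ℕ → List ℕ
shift n r S = map (λ s → (r + s) % n) S

cosetUnion : (n : ℕ) .{{_ : NonZero n}} → ℕ → ℕ → List ℕ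
cosetUnion n d a =
  filter (λ x → any? (λ r → x ∈? shift n r (subgroup n a)) (upTo d)) (upTo n)

-- Δ(A,B) = multiset { x - y mod n : x ∈ A, y ∈ B }, one entry per pair
Δ : (n : ℕ) .{{_ : NonZero n}} → List ℕ → List ℕ → List ℕ
Δ n A B = cartesianProductWith (λ x y → (x + (n ∸ y)) % n) A B

copies : ℕ → List ℕ → List ℕ
copies k S = concat (replicate k S)

IsGPSEDF : (n : ℕ) .{{_ : NonZero n}} → List ℕ → List ℕ → ℕ → Set
IsGPSEDF n A₁ A₂ lam =
  (lam * n ≡ length A₁ * length A₂) ×
  (Δ n A₁ A₂ ↭ copies lam (Zn n)) ×
  (Δ n A₂ A₁ ↭ copies lam (Zn n))

-- For z ∈ ℤ_n the multiplicity of z in Δ(A, B) is ∑_y m_B(y) · m_A(z + y). For each of the pairs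
-- (aℤ_n, bℤ_n), (⋃_{r<d} (r + aℤ_n), bℤ_n) and (bℤ_n, ⋃_{r<d} (r + aℤ_n)) the summand is the
-- indicator of a condition on y that depends only on y modulo a and modulo b, hence on y modulo l;
-- as n = λ l, the multiplicity is λ times the number of solutions modulo l. By the Chinese
-- remainder theorem there is at most one solution modulo l, and Bézout's identity provides one,
-- for the first pair exactly when d ∣ z. Multisets with equal multiplicities are permutations of
-- each other, and exchanging a and b gives the second family.

{-# OPTIONS --safe #-}
module Submission where

open import Defs
open import Data.Nat
  using (ℕ; zero; suc; pred; _+_; _*_; _∸_; _%_; _/_; ∣_-_∣; _≤_; _<_; z<s; s<s; _≟_; _<?_;
         NonZero; ≢-nonZero; ≢-nonZero⁻¹; >-nonZero⁻¹)
open import Data.Nat.Properties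
  using (+-assoc; +-comm; +-identityʳ; +-cancelˡ-≡; *-comm; *-identityˡ; *-identityʳ; *-zeroʳ;
         *-distribˡ-+; *-distribʳ-+; *-distribʳ-∣-∣; +-commutativeSemigroup; suc-injective; suc-pred;
         0≢1+n; 1+n≢0; <⇒≤; ≤-total; ≤-<-trans; <-≤-trans; m≤m*n; m+[n∸m]≡n; m∸n+n≡m;
         m≤n⇒∣m-n∣≡n∸m; m≤n⇒∣n-m∣≡n∸m; ∣m+n-m+o∣≡∣n-o∣)
open import Algebra.Properties.CommutativeSemigroup +-commutativeSemigroup
  using (interchange; x∙yz≈y∙xz; x∙yz≈yx∙z)
open import Data.Nat.DivMod
  using (m≡m%n+[m/n]*n; m%n<n; m/n*n≤m; m<n⇒m%n≡m; m%n%n≡m%n; [m+n]%n≡m%n; %-distribˡ-+;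
         %-remove-+ˡ; %-remove-+ʳ; m∣n⇒o%n%m≡o%m)
open import Data.Nat.Divisibility
  using (_∣_; divides; _∣?_; quotient; m∣n⇒n≡quotient*m; ∣-refl; ∣-trans; ∣⇒≤; 0∣⇒≡0; n∣m*n;
         ∣n⇒∣m*n; ∣m∣n⇒∣m+n; ∣m+n∣m⇒∣n; m%n≡0⇒n∣m; n∣m⇒m%n≡0; %-presˡ-∣; ∣n∣m%n⇒∣m)
open import Data.Nat.GCD using (gcd; gcd-GCD; GCD; module GCD; module Bézout)
open import Data.Nat.LCM using (lcm-least; lcm-LCM; LCM; module LCM)
open import Data.List using (List; []; _∷_; _++_; map; upTo; length; cartesianProductWith)
open import Data.List.Properties using (length-++; length-map; length-upTo)
open import Data.List.Membership.Propositional using (_∈_; _∉_; lose; find)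
open import Data.List.Membership.Propositional.Properties
  using (∈-∃++; ∈-filter⁺; ∈-filter⁻; ∈-map⁺; ∈-map⁻; ∈-upTo⁺; ∈-upTo⁻)
open import Data.List.Membership.DecPropositional _≟_ using (_∈?_)
open import Data.List.Relation.Binary.Permutation.Propositional using (_↭_; ↭-refl; ↭-prep; ↭-trans; ↭-sym)
open import Data.List.Relation.Binary.Permutation.Propositional.Properties
  using (↭-length) renaming (shift to ↭-shift)
open import Data.List.Relation.Unary.All as All using (All; []; _∷_)
import Data.List.Relation.Unary.All.Properties as All
open import Data.List.Relation.Unary.Any using (here; there; satisfied)
open import Data.List.Relation.Unary.Unique.Propositional using (Unique; _∷_)
import Data.List.Relation.Unary.Unique.Propositional.Properties as Unique
open import Data.Product using (_×_; _,_; ∃; proj₁; proj₂; swap; map₂)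
open import Data.Sum using (inj₁; inj₂)
open import Function using (_∘_)
open import Relation.Binary.PropositionalEquality
  using (_≡_; _≢_; refl; sym; trans; cong; cong₂; subst; module ≡-Reasoning; setoid)
open import Relation.Nullary using (Dec; yes; no; ¬_; contradiction)
open import Relation.Nullary.Decidable using (_×-dec_)
open import Relation.Unary using (Decidable)

private variable
  P Q R : Set

-- Indicators and finite sums

𝟙 : Dec P → ℕ
𝟙 (yes _) = 1
𝟙 (no _)  = 0

𝟙-yes : (p : Dec P) → P → 𝟙 p ≡ 1
𝟙-yes (yes _) _  = refl
𝟙-yes (no ¬p) p = contradiction p ¬p

𝟙-no : (p : Dec P) → ¬ P → 𝟙 p ≡ 0
𝟙-no (yes p) ¬p = contradiction p ¬p
𝟙-no (no _)  _  = refl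

𝟙-cong : (p : Dec P) (q : Dec Q) → (P → Q) → (Q → P) → 𝟙 p ≡ 𝟙 q
𝟙-cong (yes p) q f g = sym (𝟙-yes q (f p))
𝟙-cong (no ¬p) q f g = sym (𝟙-no q (¬p ∘ g))

𝟙-* : (p : Dec P) (q : Dec Q) (r : Dec R) → (P × Q → R) → (R → P × Q) → 𝟙 p * 𝟙 q ≡ 𝟙 r
𝟙-* (yes p) (yes q) r f g = sym (𝟙-yes r (f (p , q)))
𝟙-* (yes _) (no ¬q) r f g = sym (𝟙-no r (¬q ∘ proj₂ ∘ g))
𝟙-* (no ¬p) q       r f g = sym (𝟙-no r (¬p ∘ proj₁ ∘ g))

∑ : List ℕ → (ℕ → ℕ) → ℕ
∑ []       f = 0
∑ (x ∷ xs) f = f x + ∑ xs f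

∑< : ℕ → (ℕ → ℕ) → ℕ
∑< zero    f = 0
∑< (suc n) f = f 0 + ∑< n (f ∘ suc)

infix 5 ∑<
syntax ∑< n (λ x → e) = ∑[ x < n ] e

∑-++ : ∀ xs ys f → ∑ (xs ++ ys) f ≡ ∑ xs f + ∑ ys f
∑-++ []       ys f = refl
∑-++ (x ∷ xs) ys f = trans (cong (f x +_) (∑-++ xs ys f)) (sym (+-assoc (f x) _ _))

∑-map : ∀ g xs f → ∑ (map g xs) f ≡ ∑ xs (f ∘ g)
∑-map g []       f = refl
∑-map g (x ∷ xs) f = cong (f (g x) +_) (∑-map g xs f)

∑-cong : ∀ {xs f g} → All (λ x → f x ≡ g x) xs → ∑ xs f ≡ ∑ xs g
∑-cong []         = refl
∑-cong (e ∷ es) = cong₂ _+_ e (∑-cong es)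

∑-zero : ∀ xs → ∑ xs (λ _ → 0) ≡ 0
∑-zero []       = refl
∑-zero (x ∷ xs) = ∑-zero xs

∑-+ : ∀ xs f g → ∑ xs (λ x → f x + g x) ≡ ∑ xs f + ∑ xs g
∑-+ []       f g = refl
∑-+ (x ∷ xs) f g = trans (cong (f x + g x +_) (∑-+ xs f g)) (interchange (f x) (g x) _ _)

∑-swap : ∀ xs ys (h : ℕ → ℕ → ℕ) → ∑ xs (λ x → ∑ ys (h x)) ≡ ∑ ys (λ y → ∑ xs (λ x → h x y))
∑-swap []       ys h = sym (∑-zero ys)
∑-swap (x ∷ xs) ys h =
  trans (cong (∑ ys (h x) +_) (∑-swap xs ys h)) (sym (∑-+ ys (h x) (λ y → ∑ xs (λ x → h x y))))

∑<-cong : ∀ n {f g : ℕ → ℕ} → (∀ {x} → x < n → f x ≡ g x) → ∑[ x < n ] f x ≡ ∑[ x < n ] g x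
∑<-cong zero    e = refl
∑<-cong (suc n) e = cong₂ _+_ (e z<s) (∑<-cong n (e ∘ s<s))

∑<-zeros : ∀ n {f : ℕ → ℕ} → (∀ {x} → x < n → f x ≡ 0) → ∑[ x < n ] f x ≡ 0
∑<-zeros zero    e = refl
∑<-zeros (suc n) e = cong₂ _+_ (e z<s) (∑<-zeros n (e ∘ s<s))

∑<-single : ∀ n {f : ℕ → ℕ} {w} → w < n → (∀ {x} → x < n → x ≢ w → f x ≡ 0) → ∑[ x < n ] f x ≡ f w
∑<-single (suc n) {w = zero}  _         e =
  trans (cong (_ +_) (∑<-zeros n (λ x<n → e (s<s x<n) λ ()))) (+-identityʳ _)
∑<-single (suc n) {w = suc w} (s<s w<n) e =
  cong₂ _+_ (e z<s λ ()) (∑<-single n w<n (λ x<n x≢w → e (s<s x<n) (x≢w ∘ suc-injective)))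

∑<-+ : ∀ n (f g : ℕ → ℕ) → ∑[ x < n ] (f x + g x) ≡ (∑[ x < n ] f x) + (∑[ x < n ] g x)
∑<-+ zero    f g = refl
∑<-+ (suc n) f g = trans (cong (f 0 + g 0 +_) (∑<-+ n (f ∘ suc) (g ∘ suc))) (interchange (f 0) (g 0) _ _)

∑<-split : ∀ m k (f : ℕ → ℕ) → ∑[ x < m + k ] f x ≡ (∑[ x < m ] f x) + (∑[ x < k ] f (m + x))
∑<-split zero    k f = refl
∑<-split (suc m) k f = trans (cong (f 0 +_) (∑<-split m k (f ∘ suc)))
  (sym (+-assoc (f 0) (∑< m (f ∘ suc)) (∑< k (λ x → f (suc m + x)))))

-- Multiplicities

count : ℕ → List ℕ → ℕ
count z xs = ∑ xs (λ x → 𝟙 (x ≟ z))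

count-here : ∀ x xs → count x (x ∷ xs) ≡ suc (count x xs)
count-here x xs = cong (_+ count x xs) (𝟙-yes (x ≟ x) refl)

count-∉ : ∀ {z} xs → z ∉ xs → count z xs ≡ 0
count-∉ []       _   = refl
count-∉ (x ∷ xs) z∉ = cong₂ _+_ (𝟙-no (x ≟ _) (λ x≡z → z∉ (here (sym x≡z)))) (count-∉ xs (z∉ ∘ there))

count-∈ : ∀ {z xs} → Unique xs → z ∈ xs → count z xs ≡ 1
count-∈ {xs = x ∷ xs} (x∉xs ∷ _) (here refl) =
  trans (count-here x xs) (cong suc (count-∉ xs (All.All¬⇒¬Any x∉xs)))
count-∈ {xs = x ∷ xs} (x∉xs ∷ u) (there z∈xs) =
  cong₂ _+_ (𝟙-no (x ≟ _) (All.lookup x∉xs z∈xs)) (count-∈ u z∈xs)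

count-shift : ∀ z x ys₁ ys₂ → count z (ys₁ ++ x ∷ ys₂) ≡ 𝟙 (x ≟ z) + count z (ys₁ ++ ys₂)
count-shift z x ys₁ ys₂ = begin
  count z (ys₁ ++ x ∷ ys₂)                 ≡⟨ ∑-++ ys₁ (x ∷ ys₂) _ ⟩
  count z ys₁ + (𝟙 (x ≟ z) + count z ys₂)  ≡⟨ x∙yz≈y∙xz (count z ys₁) (𝟙 (x ≟ z)) (count z ys₂) ⟩
  𝟙 (x ≟ z) + (count z ys₁ + count z ys₂)  ≡⟨ cong (𝟙 (x ≟ z) +_) (∑-++ ys₁ ys₂ _) ⟨
  𝟙 (x ≟ z) + count z (ys₁ ++ ys₂)         ∎
  where open ≡-Reasoning

count≢0⇒∈ : ∀ {z} xs → count z xs ≢ 0 → z ∈ xs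
count≢0⇒∈ {z} xs count≢0 with z ∈? xs
... | yes z∈xs = z∈xs
... | no  z∉xs = contradiction (count-∉ xs z∉xs) count≢0

count⇒↭ : ∀ xs ys → (∀ z → count z xs ≡ count z ys) → xs ↭ ys
count⇒↭ []       []       _  = ↭-refl
count⇒↭ []       (y ∷ ys) eq = contradiction (trans (eq y) (count-here y ys)) 0≢1+n
count⇒↭ (x ∷ xs) ys       eq
  with ∈-∃++ (count≢0⇒∈ ys (λ count≡0 → 1+n≢0 (trans (sym (count-here x xs)) (trans (eq x) count≡0))))
... | ys₁ , ys₂ , refl = ↭-trans (↭-prep x (count⇒↭ xs (ys₁ ++ ys₂) eq′)) (↭-sym (↭-shift x ys₁ ys₂))
  where
  eq′ : ∀ z → count z xs ≡ count z (ys₁ ++ ys₂)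
  eq′ z = +-cancelˡ-≡ (𝟙 (x ≟ z)) _ _ (trans (eq z) (count-shift z x ys₁ ys₂))

count-copies : ∀ z k xs → count z (copies k xs) ≡ k * count z xs
count-copies z zero    xs = refl
count-copies z (suc k) xs = trans (∑-++ xs (copies k xs) _) (cong (count z xs +_) (count-copies z k xs))

count-cartesianProductWith : ∀ z (f : ℕ → ℕ → ℕ) xs ys →
  count z (cartesianProductWith f xs ys) ≡ ∑ xs (λ x → ∑ ys (λ y → 𝟙 (f x y ≟ z)))
count-cartesianProductWith z f []       ys = refl
count-cartesianProductWith z f (x ∷ xs) ys =
  trans (∑-++ (map (f x) ys) _ _) (cong₂ _+_ (∑-map (f x) ys _) (count-cartesianProductWith z f xs ys))

∑-as-∑< : ∀ {n} g {ys} → All (_< n) ys → ∑ ys g ≡ ∑[ y < n ] count y ys * g y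
∑-as-∑< {n} g []                  = sym (∑<-zeros n (λ _ → refl))
∑-as-∑< {n} g {x ∷ ys} (x<n ∷ ys<n) = sym (begin
  ∑[ y < n ] (𝟙 (x ≟ y) + count y ys) * g y
    ≡⟨ ∑<-cong n (λ {y} _ → *-distribʳ-+ (g y) (𝟙 (x ≟ y)) (count y ys)) ⟩
  ∑[ y < n ] (𝟙 (x ≟ y) * g y + count y ys * g y)
    ≡⟨ ∑<-+ n (λ y → 𝟙 (x ≟ y) * g y) (λ y → count y ys * g y) ⟩
  (∑[ y < n ] 𝟙 (x ≟ y) * g y) + (∑[ y < n ] count y ys * g y)
    ≡⟨ cong₂ _+_ (∑<-single n x<n (λ _ y≢x → cong (_* g _) (𝟙-no (x ≟ _) (y≢x ∘ sym))))
                 (sym (∑-as-∑< g ys<n)) ⟩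
  𝟙 (x ≟ x) * g x + ∑ ys g
    ≡⟨ cong (λ i → i * g x + ∑ ys g) (𝟙-yes (x ≟ x) refl) ⟩
  1 * g x + ∑ ys g
    ≡⟨ cong (_+ ∑ ys g) (*-identityˡ (g x)) ⟩
  g x + ∑ ys g ∎)
  where open ≡-Reasoning

-- Congruences and residue classes

infix 4 _≡_mod_
_≡_mod_ : ℕ → ℕ → (m : ℕ) .{{_ : NonZero m}} → Set
_≡_mod_ u v m = u % m ≡ v % m

divisor≢0 : ∀ {m n} → m ∣ n → .{{_ : NonZero n}} → NonZero m
divisor≢0 {n = n} m∣n = ≢-nonZero (λ { refl → ≢-nonZero⁻¹ n (0∣⇒≡0 m∣n) })

≡mod-+ˡ : ∀ m .{{_ : NonZero m}} c {u v} → u ≡ v mod m → c + u ≡ c + v mod m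
≡mod-+ˡ m c {u} {v} eq = begin
  (c + u) % m          ≡⟨ %-distribˡ-+ c u m ⟩
  (c % m + u % m) % m  ≡⟨ cong (λ r → (c % m + r) % m) eq ⟩
  (c % m + v % m) % m  ≡⟨ %-distribˡ-+ c v m ⟨
  (c + v) % m          ∎
  where open ≡-Reasoning

≡mod⇒∣∣-∣ : ∀ {m} .{{_ : NonZero m}} {u v} → u ≡ v mod m → m ∣ ∣ u - v ∣
≡mod⇒∣∣-∣ {m} {u} {v} eq = divides ∣ u / m - v / m ∣ (begin
  ∣ u - v ∣                                  ≡⟨ cong₂ ∣_-_∣ (m≡m%n+[m/n]*n u m) (m≡m%n+[m/n]*n v m) ⟩
  ∣ u % m + u / m * m - v % m + v / m * m ∣  ≡⟨ cong (λ r → ∣ u % m + u / m * m - r + v / m * m ∣) eq ⟨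
  ∣ u % m + u / m * m - u % m + v / m * m ∣  ≡⟨ ∣m+n-m+o∣≡∣n-o∣ (u % m) _ _ ⟩
  ∣ u / m * m - v / m * m ∣                  ≡⟨ *-distribʳ-∣-∣ m (u / m) (v / m) ⟨
  ∣ u / m - v / m ∣ * m                      ∎)
  where open ≡-Reasoning

∣∸⇒≡mod : ∀ {m} .{{_ : NonZero m}} {u v} → u ≤ v → m ∣ v ∸ u → u ≡ v mod m
∣∸⇒≡mod {m} {u} u≤v m∣v∸u = trans (sym (%-remove-+ʳ u m∣v∸u)) (cong (_% m) (m+[n∸m]≡n u≤v))

∣∣-∣⇒≡mod : ∀ {m} .{{_ : NonZero m}} {u v} → m ∣ ∣ u - v ∣ → u ≡ v mod m
∣∣-∣⇒≡mod {m} {u} {v} m∣∣u-v∣ with ≤-total u v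
... | inj₁ u≤v = ∣∸⇒≡mod u≤v (subst (m ∣_) (m≤n⇒∣m-n∣≡n∸m u≤v) m∣∣u-v∣)
... | inj₂ v≤u = sym (∣∸⇒≡mod v≤u (subst (m ∣_) (m≤n⇒∣n-m∣≡n∸m v≤u) m∣∣u-v∣))

≡mod-cancelˡ : ∀ m .{{_ : NonZero m}} c {u v} → c + u ≡ c + v mod m → u ≡ v mod m
≡mod-cancelˡ m c {u} {v} eq = ∣∣-∣⇒≡mod (subst (m ∣_) (∣m+n-m+o∣≡∣n-o∣ c u v) (≡mod⇒∣∣-∣ eq))

∣-resp-≡mod : ∀ {m} .{{_ : NonZero m}} {u v} → u ≡ v mod m → m ∣ u → m ∣ v
∣-resp-≡mod {m} {u} {v} eq m∣u = m%n≡0⇒n∣m v m (trans (sym eq) (n∣m⇒m%n≡0 u m m∣u))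

≡mod-weaken : ∀ {k m u v} .{{_ : NonZero k}} .{{_ : NonZero m}} → k ∣ m → u ≡ v mod m → u ≡ v mod k
≡mod-weaken {k} {m} {u} {v} k∣m eq =
  trans (sym (m∣n⇒o%n%m≡o%m k m u k∣m)) (trans (cong (_% k) eq) (m∣n⇒o%n%m≡o%m k m v k∣m))

≡mod-lift : ∀ {d a u v} .{{_ : NonZero d}} .{{_ : NonZero a}} →
  d ∣ a → u % a < d → v % a < d → u ≡ v mod d → u ≡ v mod a
≡mod-lift {d} {a} {u} {v} d∣a u%a<d v%a<d eq = begin
  u % a      ≡⟨ m<n⇒m%n≡m u%a<d ⟨
  u % a % d  ≡⟨ m∣n⇒o%n%m≡o%m d a u d∣a ⟩
  u % d      ≡⟨ eq ⟩
  v % d      ≡⟨ m∣n⇒o%n%m≡o%m d a v d∣a ⟨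
  v % a % d  ≡⟨ m<n⇒m%n≡m v%a<d ⟩
  v % a      ∎
  where open ≡-Reasoning

≡mod-lcm : ∀ {a b l u v} .{{_ : NonZero a}} .{{_ : NonZero b}} .{{_ : NonZero l}} →
  LCM a b l → u ≡ v mod a → u ≡ v mod b → u ≡ v mod l
≡mod-lcm isLCM eqa eqb = ∣∣-∣⇒≡mod (LCM.least isLCM (≡mod⇒∣∣-∣ eqa , ≡mod⇒∣∣-∣ eqb))

∑-residue : ∀ {l} .{{_ : NonZero l}} k {r} → r < l → ∑[ y < k * l ] 𝟙 (y % l ≟ r) ≡ k
∑-residue zero r<l = refl
∑-residue {l} (suc k) {r} r<l = trans (∑<-split l (k * l) (λ y → 𝟙 (y % l ≟ r))) (cong₂ _+_ first rest)
  where
  first : ∑[ y < l ] 𝟙 (y % l ≟ r) ≡ 1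
  first = trans (∑<-single l r<l (λ y<l y≢r → 𝟙-no (_ ≟ r) (y≢r ∘ trans (sym (m<n⇒m%n≡m y<l)))))
                (𝟙-yes (r % l ≟ r) (m<n⇒m%n≡m r<l))
  rest : ∑[ y < k * l ] 𝟙 ((l + y) % l ≟ r) ≡ k
  rest = trans (∑<-cong (k * l) (λ {y} _ → cong (λ t → 𝟙 (t ≟ r)) (%-remove-+ˡ y ∣-refl))) (∑-residue k r<l)

∑-residueClass : ∀ {l} .{{_ : NonZero l}} k {R : ℕ → Set} (R? : Decidable R) →
  (∀ {y y′} → y ≡ y′ mod l → R y → R y′) → (∀ {y y′} → R y → R y′ → y ≡ y′ mod l) → ∃ R →
  ∑[ y < k * l ] 𝟙 (R? y) ≡ k
∑-residueClass {l} k R? resp unique (y₀ , Ry₀) = trans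
  (∑<-cong (k * l) λ {y} _ → 𝟙-cong (R? y) (y % l ≟ y₀ % l) (λ Ry → unique Ry Ry₀) (λ eq → resp (sym eq) Ry₀))
  (∑-residue k (m%n<n y₀ l))

-- Solutions modulo a and b

LCM-sym : ∀ {a b l} → LCM a b l → LCM b a l
LCM-sym isLCM = record
  { commonMultiple = swap (LCM.commonMultiple isLCM)
  ; least          = LCM.least isLCM ∘ swap
  }

module ChineseRemainder {a b d l : ℕ} .{{_ : NonZero l}} (isGCD : GCD a b d) (isLCM : LCM a b l) where

  private
    a∣l = proj₁ (LCM.commonMultiple isLCM)
    b∣l = proj₂ (LCM.commonMultiple isLCM)
    d∣b = GCD.gcd∣n isGCD

  d∣a : d ∣ a
  d∣a = GCD.gcd∣m isGCD

  instance
    a≢0 : NonZero a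
    a≢0 = divisor≢0 a∣l
    b≢0 : NonZero b
    b≢0 = divisor≢0 b∣l
    d≢0 : NonZero d
    d≢0 = divisor≢0 d∣a

  d≤a : d ≤ a
  d≤a = ∣⇒≤ d∣a

  -- The conditions for y to contribute to the multiplicity of z in Δ(aℤ, bℤ) (InSubgroups z) and in
  -- Δ(⋃_{r<d} (r + aℤ), bℤ) and Δ(bℤ, ⋃_{r<d} (r + aℤ)) (InCosets z 0 and InCosets 0 z).
  InSubgroups : ℕ → ℕ → Set
  InSubgroups z y = b ∣ y × a ∣ z + y

  InCosets : ℕ → ℕ → ℕ → Set
  InCosets c e y = b ∣ e + y × (c + y) % a < d

  InSubgroups? : ∀ z → Decidable (InSubgroups z)
  InSubgroups? z y = b ∣? y ×-dec a ∣? z + y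

  InCosets? : ∀ c e → Decidable (InCosets c e)
  InCosets? c e y = b ∣? e + y ×-dec (c + y) % a <? d

  InSubgroups-resp : ∀ {z y y′} → y ≡ y′ mod l → InSubgroups z y → InSubgroups z y′
  InSubgroups-resp {z} eq (b∣y , a∣z+y) =
    ∣-resp-≡mod (≡mod-weaken b∣l eq) b∣y , ∣-resp-≡mod (≡mod-+ˡ a z (≡mod-weaken a∣l eq)) a∣z+y

  InCosets-resp : ∀ {c e y y′} → y ≡ y′ mod l → InCosets c e y → InCosets c e y′
  InCosets-resp {c} {e} eq (b∣e+y , c+y<d) =
    ∣-resp-≡mod (≡mod-+ˡ b e (≡mod-weaken b∣l eq)) b∣e+y ,
    subst (_< d) (≡mod-+ˡ a c (≡mod-weaken a∣l eq)) c+y<d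

  InCosets-unique : ∀ {c e y y′} → InCosets c e y → InCosets c e y′ → y ≡ y′ mod l
  InCosets-unique {c} {e} {y} {y′} (b∣e+y , c+y<d) (b∣e+y′ , c+y′<d) = ≡mod-lcm isLCM y≡y′[a] y≡y′[b]
    where
    y≡y′[b] : y ≡ y′ mod b
    y≡y′[b] = ≡mod-cancelˡ b e (trans (n∣m⇒m%n≡0 _ b b∣e+y) (sym (n∣m⇒m%n≡0 _ b b∣e+y′)))
    y≡y′[a] : y ≡ y′ mod a
    y≡y′[a] = ≡mod-cancelˡ a c (≡mod-lift d∣a c+y<d c+y′<d (≡mod-+ˡ d c (≡mod-weaken d∣b y≡y′[b])))

  InSubgroups⇒InCosets : ∀ {z y} → InSubgroups z y → InCosets z 0 y
  InSubgroups⇒InCosets (b∣y , a∣z+y) = b∣y , subst (_< d) (sym (n∣m⇒m%n≡0 _ a a∣z+y)) (>-nonZero⁻¹ d)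

  InSubgroups-unique : ∀ {z y y′} → InSubgroups z y → InSubgroups z y′ → y ≡ y′ mod l
  InSubgroups-unique p q = InCosets-unique (InSubgroups⇒InCosets p) (InSubgroups⇒InCosets q)

  InSubgroups⇒d∣ : ∀ {z y} → InSubgroups z y → d ∣ z
  InSubgroups⇒d∣ {z} {y} (b∣y , a∣z+y) =
    ∣m+n∣m⇒∣n (subst (d ∣_) (+-comm z y) (∣-trans d∣a a∣z+y)) (∣-trans d∣b b∣y)

  bezout : ∃ λ y → b ∣ y × a ∣ d + y
  bezout with Bézout.identity isGCD
  ... | Bézout.+- x y eq = y * b , n∣m*n y , divides x eq
  -- Here y b ≡ d (mod a), and multiplying by a - 1 ≡ -1 (mod a) turns y b into a solution.
  ... | Bézout.-+ x y eq =
    pred a * (y * b) , ∣n⇒∣m*n (pred a) (n∣m*n y) , ∣m+n∣m⇒∣n (divides (y * b) eq′) (n∣m*n x)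
    where
    eq′ : x * a + (d + pred a * (y * b)) ≡ y * b * a
    eq′ = begin
      x * a + (d + pred a * (y * b))  ≡⟨ x∙yz≈yx∙z (x * a) d _ ⟩
      d + x * a + pred a * (y * b)    ≡⟨ cong (_+ pred a * (y * b)) eq ⟩
      suc (pred a) * (y * b)          ≡⟨ cong (_* (y * b)) (suc-pred a) ⟩
      a * (y * b)                     ≡⟨ *-comm a (y * b) ⟩
      y * b * a                       ∎
      where open ≡-Reasoning

  ∃InSubgroups : ∀ {z} → d ∣ z → ∃ (InSubgroups z)
  ∃InSubgroups (divides q refl) with bezout
  ... | y , b∣y , a∣d+y = q * y , ∣n⇒∣m*n q b∣y , subst (a ∣_) (*-distribˡ-+ q d y) (∣n⇒∣m*n q a∣d+y)

  -- t = (b - 1) e makes e + t a multiple of b; a solution y for the multiple (s / d) d of d then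
  -- shifts s = c + t onto its remainder s % d < d modulo a.
  ∃InCosets : ∀ c e → ∃ (InCosets c e)
  ∃InCosets c e = t + y , b∣e+[t+y] , subst (_< d) (sym [c+[t+y]]%a≡s%d) (m%n<n s d)
    where
    t = pred b * e
    s = c + t
    sol = ∃InSubgroups (n∣m*n (s / d))
    y = proj₁ sol
    b∣e+t : b ∣ e + t
    b∣e+t = divides e (trans (cong (_* e) (suc-pred b)) (*-comm b e))
    b∣e+[t+y] : b ∣ e + (t + y)
    b∣e+[t+y] = subst (b ∣_) (+-assoc e t y) (∣m∣n⇒∣m+n b∣e+t (proj₁ (proj₂ sol)))
    [c+[t+y]]%a≡s%d : (c + (t + y)) % a ≡ s % d
    [c+[t+y]]%a≡s%d = begin
      (c + (t + y)) % a              ≡⟨ cong (_% a) (+-assoc c t y) ⟨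
      (s + y) % a                    ≡⟨ cong (λ u → (u + y) % a) (m≡m%n+[m/n]*n s d) ⟩
      (s % d + s / d * d + y) % a    ≡⟨ cong (_% a) (+-assoc (s % d) (s / d * d) y) ⟩
      (s % d + (s / d * d + y)) % a  ≡⟨ %-remove-+ʳ (s % d) (proj₂ (proj₂ sol)) ⟩
      s % d % a                      ≡⟨ m<n⇒m%n≡m (<-≤-trans (m%n<n s d) d≤a) ⟩
      s % d                          ∎
      where open ≡-Reasoning

  ∑-InSubgroups : ∀ k z → ∑[ y < k * l ] 𝟙 (InSubgroups? z y) ≡ k * 𝟙 (d ∣? z)
  ∑-InSubgroups k z with d ∣? z
  ... | yes d∣z = trans
    (∑-residueClass k (InSubgroups? z) InSubgroups-resp InSubgroups-unique (∃InSubgroups d∣z))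
    (sym (*-identityʳ k))
  ... | no  d∤z = trans
    (∑<-zeros (k * l) λ _ → 𝟙-no (InSubgroups? z _) (d∤z ∘ InSubgroups⇒d∣))
    (sym (*-zeroʳ k))

  ∑-InCosets : ∀ k c e → ∑[ y < k * l ] 𝟙 (InCosets? c e y) ≡ k
  ∑-InCosets k c e = ∑-residueClass k (InCosets? c e) InCosets-resp InCosets-unique (∃InCosets c e)

-- Multiplicities in ℤ_n

module _ {n : ℕ} .{{_ : NonZero n}} where

  [m%n+k]%n≡[m+k]%n : ∀ m k → (m % n + k) % n ≡ (m + k) % n
  [m%n+k]%n≡[m+k]%n m k = begin
    (m % n + k) % n          ≡⟨ %-distribˡ-+ (m % n) k n ⟩
    (m % n % n + k % n) % n  ≡⟨ cong (λ r → (r + k % n) % n) (m%n%n≡m%n m n) ⟩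
    (m % n + k % n) % n      ≡⟨ %-distribˡ-+ m k n ⟨
    (m + k) % n              ∎
    where open ≡-Reasoning

  [x+[n∸y]]%n≡z⇒x≡[z+y]%n : ∀ {x y z} → x < n → y < n → (x + (n ∸ y)) % n ≡ z → x ≡ (z + y) % n
  [x+[n∸y]]%n≡z⇒x≡[z+y]%n {x} {y} x<n y<n refl = sym (begin
    ((x + (n ∸ y)) % n + y) % n  ≡⟨ [m%n+k]%n≡[m+k]%n (x + (n ∸ y)) y ⟩
    (x + (n ∸ y) + y) % n        ≡⟨ cong (_% n) (+-assoc x (n ∸ y) y) ⟩
    (x + (n ∸ y + y)) % n        ≡⟨ cong (λ u → (x + u) % n) (m∸n+n≡m (<⇒≤ y<n)) ⟩
    (x + n) % n                  ≡⟨ [m+n]%n≡m%n x n ⟩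
    x % n                        ≡⟨ m<n⇒m%n≡m x<n ⟩
    x                            ∎)
    where open ≡-Reasoning

  x≡[z+y]%n⇒[x+[n∸y]]%n≡z : ∀ {x y z} → z < n → y < n → x ≡ (z + y) % n → (x + (n ∸ y)) % n ≡ z
  x≡[z+y]%n⇒[x+[n∸y]]%n≡z {x} {y} {z} z<n y<n refl = begin
    ((z + y) % n + (n ∸ y)) % n  ≡⟨ [m%n+k]%n≡[m+k]%n (z + y) (n ∸ y) ⟩
    (z + y + (n ∸ y)) % n        ≡⟨ cong (_% n) (+-assoc z y (n ∸ y)) ⟩
    (z + (y + (n ∸ y))) % n      ≡⟨ cong (λ u → (z + u) % n) (m+[n∸m]≡n (<⇒≤ y<n)) ⟩
    (z + n) % n                  ≡⟨ [m+n]%n≡m%n z n ⟩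
    z % n                        ≡⟨ m<n⇒m%n≡m z<n ⟩
    z                            ∎
    where open ≡-Reasoning

  count-Δ : ∀ {A B z} → All (_< n) A → All (_< n) B → z < n →
    count z (Δ n A B) ≡ ∑[ y < n ] count y B * count ((z + y) % n) A
  count-Δ {A} {B} {z} A<n B<n z<n = begin
    count z (Δ n A B)
      ≡⟨ count-cartesianProductWith z _ A B ⟩
    ∑ A (λ x → ∑ B (λ y → 𝟙 ((x + (n ∸ y)) % n ≟ z)))
      ≡⟨ ∑-swap A B _ ⟩
    ∑ B (λ y → ∑ A (λ x → 𝟙 ((x + (n ∸ y)) % n ≟ z)))
      ≡⟨ ∑-cong (All.map (λ {y} y<n → ∑-cong (All.map (λ {x} x<n → 𝟙-cong _ _
           ([x+[n∸y]]%n≡z⇒x≡[z+y]%n x<n y<n) (x≡[z+y]%n⇒[x+[n∸y]]%n≡z z<n y<n)) A<n)) B<n) ⟩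
    ∑ B (λ y → count ((z + y) % n) A)
      ≡⟨ ∑-as-∑< _ B<n ⟩
    ∑[ y < n ] count y B * count ((z + y) % n) A ∎
    where open ≡-Reasoning

  module _ {a : ℕ} (a∣n : a ∣ n) where

    private instance
      a≢0 : NonZero a
      a≢0 = divisor≢0 a∣n

    ∈-subgroup⁺ : ∀ {x} → x < n → a ∣ x → x ∈ subgroup n a
    ∈-subgroup⁺ x<n (divides q refl) =
      ∈-filter⁺ _ (∈-upTo⁺ x<n) (lose (∈-upTo⁺ (≤-<-trans (m≤m*n q a) x<n)) (m<n⇒m%n≡m x<n))

    ∈-subgroup⁻ : ∀ {x} → x ∈ subgroup n a → a ∣ x
    ∈-subgroup⁻ x∈aℤ with satisfied (proj₂ (∈-filter⁻ _ {xs = upTo n} x∈aℤ))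
    ... | k , refl = %-presˡ-∣ (n∣m*n k) a∣n

    ∈-cosetUnion⁺ : ∀ {d x} → x < n → x % a < d → x ∈ cosetUnion n d a
    ∈-cosetUnion⁺ {d} {x} x<n x%a<d = ∈-filter⁺ _ (∈-upTo⁺ x<n) (lose (∈-upTo⁺ x%a<d) x∈x%a+aℤ)
      where
      x∈x%a+aℤ : x ∈ shift n (x % a) (subgroup n a)
      x∈x%a+aℤ = subst (_∈ shift n (x % a) (subgroup n a))
        (trans (cong (_% n) (sym (m≡m%n+[m/n]*n x a))) (m<n⇒m%n≡m x<n))
        (∈-map⁺ (λ s → (x % a + s) % n) (∈-subgroup⁺ (≤-<-trans (m/n*n≤m x a) x<n) (n∣m*n (x / a))))

    ∈-cosetUnion⁻ : ∀ {d x} → d ≤ a → x ∈ cosetUnion n d a → x % a < d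
    ∈-cosetUnion⁻ {d} d≤a x∈ with find (proj₂ (∈-filter⁻ _ {xs = upTo n} x∈))
    ... | r , r∈upTo , x∈r+aℤ with ∈-map⁻ (λ s → (r + s) % n) x∈r+aℤ
    ... | s , s∈aℤ , refl = subst (_< d) (sym (begin
          (r + s) % n % a  ≡⟨ m∣n⇒o%n%m≡o%m a n (r + s) a∣n ⟩
          (r + s) % a      ≡⟨ %-remove-+ʳ r (∈-subgroup⁻ s∈aℤ) ⟩
          r % a            ≡⟨ m<n⇒m%n≡m (<-≤-trans (∈-upTo⁻ r∈upTo) d≤a) ⟩
          r                ∎)) (∈-upTo⁻ r∈upTo)
      where open ≡-Reasoning

    count-subgroup : ∀ {w} → w < n → count w (subgroup n a) ≡ 𝟙 (a ∣? w)
    count-subgroup {w} w<n with a ∣? w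
    ... | yes a∣w = count-∈ (Unique.filter⁺ _ (Unique.upTo⁺ n)) (∈-subgroup⁺ w<n a∣w)
    ... | no  a∤w = count-∉ _ (a∤w ∘ ∈-subgroup⁻)

    count-cosetUnion : ∀ {d w} → d ≤ a → w < n → count w (cosetUnion n d a) ≡ 𝟙 (w % a <? d)
    count-cosetUnion {d} {w} d≤a w<n with w % a <? d
    ... | yes w%a<d = count-∈ (Unique.filter⁺ _ (Unique.upTo⁺ n)) (∈-cosetUnion⁺ w<n w%a<d)
    ... | no  w%a≮d = count-∉ _ (w%a≮d ∘ ∈-cosetUnion⁻ d≤a)

  count<⇒↭ : ∀ {xs ys} → All (_< n) xs → All (_< n) ys →
    (∀ {z} → z < n → count z xs ≡ count z ys) → xs ↭ ys
  count<⇒↭ {xs} {ys} xs<n ys<n eq = count⇒↭ xs ys agree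
    where
    agree : ∀ z → count z xs ≡ count z ys
    agree z with z <? n
    ... | yes z<n = eq z<n
    ... | no  z≮n = trans (count-∉ xs (z≮n ∘ All.lookup xs<n)) (sym (count-∉ ys (z≮n ∘ All.lookup ys<n)))

  Δ-bounded : ∀ A B → All (_< n) (Δ n A B)
  Δ-bounded A B = All.cartesianProductWith⁺ (setoid ℕ) (setoid ℕ) _ A B (λ _ _ → m%n<n _ n)

  subgroup-bounded : ∀ a → All (_< n) (subgroup n a)
  subgroup-bounded a = All.filter⁺ _ (All.all-upTo n)

  cosetUnion-bounded : ∀ d a → All (_< n) (cosetUnion n d a)
  cosetUnion-bounded d a = All.filter⁺ _ (All.all-upTo n)

  copies-bounded : ∀ k {xs} → All (_< n) xs → All (_< n) (copies k xs)
  copies-bounded k xs<n = All.concat⁺ (All.replicate⁺ k xs<n)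

  ↭-copies-Zn : ∀ {k xs} → All (_< n) xs → (∀ {z} → z < n → count z xs ≡ k) → xs ↭ copies k (Zn n)
  ↭-copies-Zn {k} xs<n eq = count<⇒↭ xs<n (copies-bounded k (All.all-upTo n)) λ {z} z<n →
    trans (eq z<n) (sym (trans (count-copies z k (upTo n))
      (trans (cong (k *_) (count-∈ (Unique.upTo⁺ n) (∈-upTo⁺ z<n))) (*-identityʳ k))))

-- The difference multisets

length-cartesianProductWith : ∀ (f : ℕ → ℕ → ℕ) xs ys →
  length (cartesianProductWith f xs ys) ≡ length xs * length ys
length-cartesianProductWith f []       ys = refl
length-cartesianProductWith f (x ∷ xs) ys =
  trans (length-++ (map (f x) ys)) (cong₂ _+_ (length-map (f x) ys) (length-cartesianProductWith f xs ys))

length-copies : ∀ k xs → length (copies k xs) ≡ k * length xs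
length-copies zero    xs = refl
length-copies (suc k) xs = trans (length-++ xs) (cong (length xs +_) (length-copies k xs))

↭-copies⇒IsGPSEDF : ∀ {n} .{{_ : NonZero n}} A B k →
  Δ n A B ↭ copies k (Zn n) → Δ n B A ↭ copies k (Zn n) → IsGPSEDF n A B k
↭-copies⇒IsGPSEDF {n} A B k ΔAB↭ ΔBA↭ = k*n≡|A|*|B| , ΔAB↭ , ΔBA↭
  where
  k*n≡|A|*|B| : k * n ≡ length A * length B
  k*n≡|A|*|B| = begin
    k * n                     ≡⟨ cong (k *_) (length-upTo n) ⟨
    k * length (upTo n)       ≡⟨ length-copies k (upTo n) ⟨
    length (copies k (Zn n))  ≡⟨ ↭-length ΔAB↭ ⟨
    length (Δ n A B)          ≡⟨ length-cartesianProductWith _ A B ⟩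
    length A * length B       ∎
    where open ≡-Reasoning

module Differences {n a b d l k : ℕ} .{{_ : NonZero n}} (isGCD : GCD a b d) (isLCM : LCM a b l)
  (a∣n : a ∣ n) (b∣n : b ∣ n) (n≡k*l : n ≡ k * l) where

  private instance
    l≢0 : NonZero l
    l≢0 = divisor≢0 (LCM.least isLCM (a∣n , b∣n))

  open ChineseRemainder isGCD isLCM

  count-Δ≡∑𝟙 : ∀ {A B z} {R : ℕ → Set} (R? : Decidable R) → All (_< n) A → All (_< n) B → z < n →
    (∀ {y} → y < n → count y B * count ((z + y) % n) A ≡ 𝟙 (R? y)) →
    count z (Δ n A B) ≡ ∑[ y < k * l ] 𝟙 (R? y)
  count-Δ≡∑𝟙 R? A<n B<n z<n summand =
    trans (count-Δ A<n B<n z<n) (trans (∑<-cong n summand) (cong (λ m → ∑[ y < m ] 𝟙 (R? y)) n≡k*l))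

  count-Δ-subgroups : ∀ {z} → z < n → count z (Δ n (subgroup n a) (subgroup n b)) ≡ k * 𝟙 (d ∣? z)
  count-Δ-subgroups {z} z<n = trans
    (count-Δ≡∑𝟙 (InSubgroups? z) (subgroup-bounded a) (subgroup-bounded b) z<n summand) (∑-InSubgroups k z)
    where
    summand : ∀ {y} → y < n →
      count y (subgroup n b) * count ((z + y) % n) (subgroup n a) ≡ 𝟙 (InSubgroups? z y)
    summand {y} y<n = trans (cong₂ _*_ (count-subgroup b∣n y<n) (count-subgroup a∣n (m%n<n (z + y) n)))
      (𝟙-* (b ∣? y) (a ∣? (z + y) % n) (InSubgroups? z y)
        (map₂ (∣n∣m%n⇒∣m a∣n)) (map₂ (λ a∣z+y → %-presˡ-∣ a∣z+y a∣n)))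

  count-Δ-cosetUnion-subgroup : ∀ {z} → z < n → count z (Δ n (cosetUnion n d a) (subgroup n b)) ≡ k
  count-Δ-cosetUnion-subgroup {z} z<n = trans
    (count-Δ≡∑𝟙 (InCosets? z 0) (cosetUnion-bounded d a) (subgroup-bounded b) z<n summand) (∑-InCosets k z 0)
    where
    [z+y]%n%a≡[z+y]%a : ∀ y → (z + y) % n % a ≡ (z + y) % a
    [z+y]%n%a≡[z+y]%a y = m∣n⇒o%n%m≡o%m a n (z + y) a∣n
    summand : ∀ {y} → y < n →
      count y (subgroup n b) * count ((z + y) % n) (cosetUnion n d a) ≡ 𝟙 (InCosets? z 0 y)
    summand {y} y<n = trans (cong₂ _*_ (count-subgroup b∣n y<n) (count-cosetUnion a∣n d≤a (m%n<n (z + y) n)))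
      (𝟙-* (b ∣? y) ((z + y) % n % a <? d) (InCosets? z 0 y)
        (map₂ (subst (_< d) ([z+y]%n%a≡[z+y]%a y))) (map₂ (subst (_< d) (sym ([z+y]%n%a≡[z+y]%a y)))))

  count-Δ-subgroup-cosetUnion : ∀ {z} → z < n → count z (Δ n (subgroup n b) (cosetUnion n d a)) ≡ k
  count-Δ-subgroup-cosetUnion {z} z<n = trans
    (count-Δ≡∑𝟙 (InCosets? 0 z) (subgroup-bounded b) (cosetUnion-bounded d a) z<n summand) (∑-InCosets k 0 z)
    where
    summand : ∀ {y} → y < n →
      count y (cosetUnion n d a) * count ((z + y) % n) (subgroup n b) ≡ 𝟙 (InCosets? 0 z y)
    summand {y} y<n = trans (cong₂ _*_ (count-cosetUnion a∣n d≤a y<n) (count-subgroup b∣n (m%n<n (z + y) n)))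
      (𝟙-* (y % a <? d) (b ∣? (z + y) % n) (InCosets? 0 z y)
        (λ (y%a<d , b∣[z+y]%n) → ∣n∣m%n⇒∣m b∣n b∣[z+y]%n , y%a<d)
        (λ (b∣z+y , y%a<d) → y%a<d , %-presˡ-∣ b∣z+y b∣n))

  Δ-subgroups : Δ n (subgroup n a) (subgroup n b) ↭ copies k (subgroup n d)
  Δ-subgroups = count<⇒↭ (Δ-bounded (subgroup n a) (subgroup n b)) (copies-bounded k (subgroup-bounded d))
    λ {z} z<n → trans (count-Δ-subgroups z<n)
      (sym (trans (count-copies z k (subgroup n d)) (cong (k *_) (count-subgroup (∣-trans d∣a a∣n) z<n))))

  Δ-cosetUnion-subgroup : Δ n (cosetUnion n d a) (subgroup n b) ↭ copies k (Zn n)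
  Δ-cosetUnion-subgroup = ↭-copies-Zn (Δ-bounded (cosetUnion n d a) (subgroup n b)) count-Δ-cosetUnion-subgroup

  Δ-subgroup-cosetUnion : Δ n (subgroup n b) (cosetUnion n d a) ↭ copies k (Zn n)
  Δ-subgroup-cosetUnion = ↭-copies-Zn (Δ-bounded (subgroup n b) (cosetUnion n d a)) count-Δ-subgroup-cosetUnion

  cosetUnion-subgroup-IsGPSEDF : IsGPSEDF n (cosetUnion n d a) (subgroup n b) k
  cosetUnion-subgroup-IsGPSEDF =
    ↭-copies⇒IsGPSEDF (cosetUnion n d a) (subgroup n b) k Δ-cosetUnion-subgroup Δ-subgroup-cosetUnion

  subgroup-cosetUnion-IsGPSEDF : IsGPSEDF n (subgroup n b) (cosetUnion n d a) k
  subgroup-cosetUnion-IsGPSEDF =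
    ↭-copies⇒IsGPSEDF (subgroup n b) (cosetUnion n d a) k Δ-subgroup-cosetUnion Δ-cosetUnion-subgroup

lemma4p7 : (n : ℕ) .{{_ : NonZero n}} (a b : ℕ) (a∣n : a ∣ n) (b∣n : b ∣ n) → a ≢ b →
    let d = gcd a b
        lam = quotient (lcm-least a∣n b∣n)
    in (Δ n (subgroup n a) (subgroup n b) ↭ copies lam (subgroup n d))
       × (1 < d →
           (Δ n (cosetUnion n d a) (subgroup n b) ↭ Δ n (subgroup n a) (cosetUnion n d b))
           × (Δ n (cosetUnion n d a) (subgroup n b) ↭ copies lam (Zn n))
           × IsGPSEDF n (cosetUnion n d a) (subgroup n b) lam
           × IsGPSEDF n (subgroup n a) (cosetUnion n d b) lam)
lemma4p7 n a b a∣n b∣n _ =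
  D.Δ-subgroups ,
  λ _ → ↭-trans D.Δ-cosetUnion-subgroup (↭-sym D′.Δ-subgroup-cosetUnion) ,
        D.Δ-cosetUnion-subgroup ,
        D.cosetUnion-subgroup-IsGPSEDF ,
        D′.subgroup-cosetUnion-IsGPSEDF
  where
  l∣n = lcm-least a∣n b∣n
  n≡lam*l = m∣n⇒n≡quotient*m l∣n
  g = gcd-GCD a b
  L = lcm-LCM a b
  module D  = Differences {k = quotient l∣n} g L a∣n b∣n n≡lam*l
  module D′ = Differences {k = quotient l∣n} (GCD.sym g) (LCM-sym L) b∣n a∣n n≡lam*l
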